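{- Let $n$ be even, let $A$ be an abelian group of order $n$ that is not an elementary abelian $2$-group, and let $G=D(A)=\langle x,A\mid x^2=1,\ xax=a^{ -1}\ \forall a\in A\rangle$ act on the $n$ left cosets of $H=\langle x\rangle$, so $G\le\mathrm{Sym}(n)$. If $C$ is an inverse-closed set with $A\setminus\{1\}\subseteq C\subseteq\mathrm{Der}(G)$, then $\alpha(\mathrm{Cay}(G,C))=\alpha(\Gamma_G)=2$.
   Context: A derangement is an element fixing no coset; $\mathrm{Der}(G)$ is the set of derangements. For inverse-closed $S\subseteq G$ not containing the identity, $\mathrm{Cay}(G,S)$ is the graph on $G$ with $g,h$ adjacent iff $g^{ -1}h\in S$; $\Gamma_G=\mathrm{Cay}(G,\mathrm{Der}(G))$; $\alpha$ denotes independence number. -}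

module Defs where

open import Level using (Level; _⊔_)
open import Algebra.Bundles using (AbelianGroup)
open import Data.Bool using (Bool; true; false; _xor_)
open import Data.Product using (_×_; _,_; Σ; ∃)
open import Data.Nat using (ℕ; _≤_)
open import Data.Fin using (Fin)
open import Data.List using (List; length)
open import Data.List.Relation.Unary.AllPairs using (AllPairs)
open import Relation.Nullary using (¬_)
open import Relation.Binary.PropositionalEquality as P using (_≡_)
open import Function.Bundles using (Inverse)

HasOrder : ∀ {c ℓ} → AbelianGroup c ℓ → ℕ → Set _
HasOrder A n = Inverse (AbelianGroup.setoid A) (P.setoid (Fin n))

ElemAbelian2 : ∀ {c ℓ} → AbelianGroup c ℓ → Set _
ElemAbelian2 A = ∀ a → (a ∙ a) ≈ ε
  where open AbelianGroup A

-- The generalized dihedral group D(A) = A ⋊ ⟨x⟩, x² = 1, x a x = a⁻¹.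
-- The element (a , s) stands for  a x^s  (s = true means the factor x is present).
module Dihedral {c ℓ} (A : AbelianGroup c ℓ) where
  open AbelianGroup A renaming (Carrier to Ac; _≈_ to _≈A_; _∙_ to _·_; ε to e; _⁻¹ to inv)

  G : Set c
  G = Ac × Bool

  _≈_ : G → G → Set ℓ
  (a , s) ≈ (b , t) = (a ≈A b) × (s ≡ t)

  conj : Bool → Ac → Ac
  conj false b = b
  conj true  b = inv b

  -- (a x^s)(b x^t) = a (x^s b x^s) x^{s+t}
  _∙_ : G → G → G
  (a , s) ∙ (b , t) = (a · conj s b , s xor t)

  1G : G
  1G = (e , false)

  _⁻¹ : G → G
  (a , false) ⁻¹ = (inv a , false)
  (a , true)  ⁻¹ = (a , true)

  x : G
  x = (e , true)

  ι : Ac → G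
  ι a = (a , false)

  InH : G → Set ℓ
  InH g = (g ≈ 1G) Data.Sum.⊎ (g ≈ x)
    where import Data.Sum

  -- g fixes the left coset yH  iff  g y H = y H  iff  y⁻¹ g y ∈ H
  FixesCoset : G → G → Set ℓ
  FixesCoset g y = InH (((y ⁻¹) ∙ g) ∙ y)

  Der : G → Set (c ⊔ ℓ)
  Der g = ∀ y → ¬ FixesCoset g y

  Adj : ∀ {p} → (G → Set p) → G → G → Set p
  Adj S g h = S ((g ⁻¹) ∙ h)

  Independent : ∀ {p} → (G → Set p) → List G → Set (c ⊔ ℓ ⊔ p)
  Independent S = AllPairs (λ g h → ¬ (g ≈ h) × ¬ Adj S g h × ¬ Adj S h g)

  IndependenceNumber : ∀ {p} → (G → Set p) → ℕ → Set (c ⊔ ℓ ⊔ p)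
  IndependenceNumber S k =
    (Σ (List G) λ L → Independent S L × length L ≡ k)
    × (∀ L → Independent S L → length L ≤ k)

  Respects : ∀ {p} → (G → Set p) → Set (c ⊔ ℓ ⊔ p)
  Respects S = ∀ {g h} → g ≈ h → S g → S h

  InverseClosed : ∀ {p} → (G → Set p) → Set (c ⊔ p)
  InverseClosed S = ∀ g → S g → S (g ⁻¹)

-- G = D(A) is the union of the two cosets A and Ax of A. Two distinct elements
-- of the same coset differ by some a ∈ A ∖ {1}; every conjugate of such an a
-- lies again in A ∖ {1}, which misses H = {1, x}, so a is a derangement and the
-- two elements are adjacent. Hence an independent set meets each coset at most
-- once, while {1, x} is independent because x fixes the coset H itself.
module Submission where

open import Defs
open import Level using (Level)
open import Algebra.Bundles using (AbelianGroup)
open import Data.Nat using (ℕ)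
open import Data.Nat.Divisibility using (_∣_)
open import Relation.Nullary using (¬_)
open import Data.Product using (_×_)

open import Data.Bool using (Bool; true; false)
open import Data.Empty using (⊥-elim)
open import Data.List using (_∷_; []; length)
open import Data.List.Relation.Unary.AllPairs using (_∷_; [])
open import Data.List.Relation.Unary.All using (_∷_; [])
open import Data.Nat using (_≤_; z≤n; s≤s)
open import Data.Product using (_,_; proj₂)
open import Data.Sum using (_⊎_; inj₁; inj₂; [_,_])
open import Function using (_∘_)
open import Relation.Binary.PropositionalEquality using (_≡_; refl)
open import Relation.Unary using (Pred; _⊆′_)
import Algebra.Properties.Group as GroupProperties
import Algebra.Properties.AbelianGroup as AbelianGroupProperties

three-bools-pigeonhole : (s t u : Bool) → s ≡ t ⊎ s ≡ u ⊎ t ≡ u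
three-bools-pigeonhole false false _     = inj₁ refl
three-bools-pigeonhole true  true  _     = inj₁ refl
three-bools-pigeonhole false true  false = inj₂ (inj₁ refl)
three-bools-pigeonhole true  false true  = inj₂ (inj₁ refl)
three-bools-pigeonhole false true  true  = inj₂ (inj₂ refl)
three-bools-pigeonhole true  false false = inj₂ (inj₂ refl)

module Derangements {c ℓ} (A : AbelianGroup c ℓ) where
  open Dihedral A
  open AbelianGroup A
    renaming (refl to ≈A-refl; Carrier to Ac; _≈_ to _≈A_; _∙_ to _·_; ε to e; _⁻¹ to inv)
  open GroupProperties group
  open AbelianGroupProperties A using (xyx⁻¹≈y)
  open import Relation.Binary.Reasoning.Setoid setoid

  A∖1 : Pred Ac ℓ
  A∖1 a = ¬ (a ≈A e)

  NonAdjacent : ∀ {p} → Pred G p → G → G → Set _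
  NonAdjacent S g h = ¬ (g ≈ h) × ¬ Adj S g h × ¬ Adj S h g

  x⁻¹∙y≈ε⇒x≈y : ∀ a b → (inv a · b) ≈A e → a ≈A b
  x⁻¹∙y≈ε⇒x≈y a b h = ⁻¹-injective (inverseˡ-unique (inv a) b h)

  x⁻¹≈ε⇒x≈ε : ∀ {a} → inv a ≈A e → a ≈A e
  x⁻¹≈ε⇒x≈ε h = ⁻¹-injective (trans h (sym ε⁻¹≈ε))

  y⁻¹xy≈x : ∀ a b → (inv b · a) · b ≈A a
  y⁻¹xy≈x a b = begin
    (inv b · a) · b           ≈⟨ ∙-congˡ (⁻¹-involutive b) ⟨
    (inv b · a) · inv (inv b) ≈⟨ xyx⁻¹≈y (inv b) a ⟩
    a                         ∎

  ε⁻¹∙x∙y≈x : ∀ a {b} → b ≈A e → (inv e · a) · b ≈A a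
  ε⁻¹∙x∙y≈x a {b} b≈e = begin
    (inv e · a) · b ≈⟨ ∙-congʳ (∙-congʳ ε⁻¹≈ε) ⟩
    (e · a) · b     ≈⟨ ∙-cong (identityˡ a) b≈e ⟩
    a · e           ≈⟨ identityʳ a ⟩
    a               ∎

  ≈-trans : ∀ {g h k} → g ≈ h → h ≈ k → g ≈ k
  ≈-trans (p , refl) (q , refl) = trans p q , refl

  ≈-sym : ∀ {g h} → g ≈ h → h ≈ g
  ≈-sym (p , refl) = sym p , refl

  InH-resp-≈ : ∀ {g h} → g ≈ h → InH g → InH h
  InH-resp-≈ g≈h (inj₁ g≈1) = inj₁ (≈-trans (≈-sym g≈h) g≈1)
  InH-resp-≈ g≈h (inj₂ g≈x) = inj₂ (≈-trans (≈-sym g≈h) g≈x)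

  conjugate-by-1G : ∀ g → (((1G ⁻¹) ∙ g) ∙ 1G) ≈ g
  conjugate-by-1G (a , false) = ε⁻¹∙x∙y≈x a ≈A-refl , refl
  conjugate-by-1G (a , true)  = ε⁻¹∙x∙y≈x a ε⁻¹≈ε , refl

  InH⇒¬Der : ∀ {g} → InH g → ¬ Der g
  InH⇒¬Der {g} g∈H der = der 1G (InH-resp-≈ (≈-sym (conjugate-by-1G g)) g∈H)

  A∖1⊆Der : A∖1 ⊆′ Der ∘ ι
  A∖1⊆Der a a≉e (b , false) (inj₁ (h , _)) = a≉e (trans (sym (y⁻¹xy≈x a b)) h)
  A∖1⊆Der a a≉e (b , true)  (inj₁ (h , _)) =
    a≉e (x⁻¹≈ε⇒x≈ε (trans (sym (xyx⁻¹≈y b (inv a))) h))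
  A∖1⊆Der a a≉e (b , false) (inj₂ (_ , ()))
  A∖1⊆Der a a≉e (b , true)  (inj₂ (_ , ()))

  module _ {p} (S : Pred G p) where

    -- (a x^s)⁻¹ (b x^s) lies in A, and is trivial only when a ≈ b.
    sameCoset⇒¬NonAdjacent : A∖1 ⊆′ S ∘ ι →
      ∀ {g h} → proj₂ g ≡ proj₂ h → ¬ NonAdjacent S g h
    sameCoset⇒¬NonAdjacent A∖1⊆S {a , false} {b , _} refl (g≉h , ¬g~h , _) =
      ¬g~h (A∖1⊆S _ (λ h → g≉h (x⁻¹∙y≈ε⇒x≈y a b h , refl)))
    sameCoset⇒¬NonAdjacent A∖1⊆S {a , true} {b , _} refl (g≉h , ¬g~h , _) =
      ¬g~h (A∖1⊆S _ (λ h → g≉h (x∙y⁻¹≈ε⇒x≈y a b h , refl)))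

    independent⇒length≤2 : A∖1 ⊆′ S ∘ ι →
      ∀ L → Independent S L → length L ≤ 2
    independent⇒length≤2 _ []              _ = z≤n
    independent⇒length≤2 _ (_ ∷ [])        _ = s≤s z≤n
    independent⇒length≤2 _ (_ ∷ _ ∷ [])    _ = s≤s (s≤s z≤n)
    independent⇒length≤2 A∖1⊆S (g ∷ h ∷ k ∷ _) ((gh ∷ gk ∷ _) ∷ (hk ∷ _) ∷ _) =
      ⊥-elim ([ (λ eq → sameCoset eq gh)
              , [ (λ eq → sameCoset eq gk) , (λ eq → sameCoset eq hk) ] ]
              (three-bools-pigeonhole (proj₂ g) (proj₂ h) (proj₂ k)))
      where
      sameCoset : ∀ {g h} → proj₂ g ≡ proj₂ h → ¬ NonAdjacent S g h
      sameCoset = sameCoset⇒¬NonAdjacent A∖1⊆S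

    1G-x-independent : S ⊆′ Der → Independent S (1G ∷ x ∷ [])
    1G-x-independent S⊆Der =
      (((λ { (_ , ()) })
      , (λ s → InH⇒¬Der (inj₂ (inverseˡ e , refl)) (S⊆Der _ s))
      , (λ s → InH⇒¬Der (inj₂ (inverseʳ e , refl)) (S⊆Der _ s))
      ) ∷ []) ∷ [] ∷ []

    independenceNumber≡2 : A∖1 ⊆′ S ∘ ι → S ⊆′ Der → IndependenceNumber S 2
    independenceNumber≡2 A∖1⊆S S⊆Der =
      (1G ∷ x ∷ [] , 1G-x-independent S⊆Der , refl) , independent⇒length≤2 A∖1⊆S

lemma4p7 : ∀ {c ℓ p : Level} (n : ℕ) → 2 ∣ n →
    (A : AbelianGroup c ℓ) → HasOrder A n → ¬ ElemAbelian2 A →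
    let open Dihedral A
        open AbelianGroup A using (ε) renaming (_≈_ to _≈A_)
    in (C : G → Set p) → Respects C → InverseClosed C →
       (∀ a → ¬ (a ≈A ε) → C (ι a)) → (∀ g → C g → Der g) →
       IndependenceNumber C 2 × IndependenceNumber Der 2
lemma4p7 _ _ A _ _ C _ _ A∖1⊆C C⊆Der =
  independenceNumber≡2 C A∖1⊆C C⊆Der , independenceNumber≡2 Der A∖1⊆Der (λ _ d → d)
  where open Dihedral A using (Der)
        open Derangements A
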